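{- Define $\mathscr{C}_0:=1$ and, recursively for $k\in\mathbb{N}$, \[ \mathscr{C}_k:=-\sum_{\mu=1}^{k} (-1)^\mu \frac{(2k-\mu)!}{\mu!(2k-2\mu)!} \mathscr{C}_{k-\mu}. \] Then for every $k\in\mathbb{N}_0$ we have $\mathscr{C}_k=C_k:=\frac{1}{k+1}\binom{2k}{k}$.
   Context: $C_k$ denotes the $k$-th Catalan number. -}

module Defs where

open import Data.Nat as ℕ using (ℕ; zero; suc; _∸_; _!)
open import Data.Nat.DivMod using (_/_)
open import Data.Nat.Combinatorics using (_C_)
open import Data.Nat.Properties using (_!≢0; _!*_!≢0)
open import Data.Integer as ℤ using (ℤ; +_; -_)
open import Data.List using (List; []; _∷_; upTo; map; sum; length)
open import Data.Vec using (Vec; []; _∷_; lookup)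
open import Data.Fin using (Fin; fromℕ<)

-- Coefficient  (2k-μ)! / (μ! (2k-2μ)!)  as an exact natural number quotient
-- (for 1 ≤ μ ≤ k it is an integer, namely binom(2k-μ, μ)).
coeff : ℕ → ℕ → ℕ
coeff k μ = ((2 ℕ.* k ∸ μ) !) / ((μ !) ℕ.* ((2 ℕ.* k ∸ 2 ℕ.* μ) !))
  where instance _ = (μ !* (2 ℕ.* k ∸ 2 ℕ.* μ) !≢0)

sgn : ℕ → ℤ
sgn zero = + 1
sgn (suc μ) = - sgn μ

-- tab k = [𝒞_k, 𝒞_{k-1}, …, 𝒞_0]  (so index j holds 𝒞_{k-j})
-- Next value: 𝒞_{k+1} = - Σ_{μ=1}^{k+1} (-1)^μ coeff(k+1,μ) 𝒞_{k+1-μ},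
-- and 𝒞_{k+1-μ} is at index μ-1 of tab k.
step : (k : ℕ) → Vec ℤ (suc k) → ℤ
step k v = - go 1 v
    where
      go : (μ : ℕ) → {n : ℕ} → Vec ℤ n → ℤ
      go μ [] = + 0
      go μ (c ∷ cs) = sgn μ ℤ.* (+ coeff (suc k) μ) ℤ.* c ℤ.+ go (suc μ) cs

tab : (k : ℕ) → Vec ℤ (suc k)
tab zero = + 1 ∷ []
tab (suc k) = step k (tab k) ∷ tab k

scrC : ℕ → ℤ
scrC k = lookup (tab k) Data.Fin.zero

catalan : ℕ → ℕ
catalan k = ((2 ℕ.* k) C k) / suc k

{-# OPTIONS --safe #-}
-- Writing μ = k − i, the recursion reads 𝒞_k = −Σ_{i<k} c(k, i) 𝒞_i with
-- c(K, i) = (−1)^{K+i} binom(K+i, 2i), and c(k, k) = 1. Pascal's rule gives these coefficients the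
-- recurrence c(K+2, i+1) = c(K+1, i) − 2c(K+1, i+1) − c(K, i+1), which is also satisfied in the
-- form b(m, K+2) = b(m+1, K+1) − 2b(m, K+1) − b(m, K) by the ballot numbers
-- b(m, j) = binom(2m, m+j) − binom(2m, m+j+1). So induction on K gives Σ_i c(K, i) b(m+i, 0) = b(m, K).
-- Since b(m, 0) = C_m and b(0, K) = 0 for K ≥ 1, the case m = 0 says that the Catalan numbers satisfy
-- the recursion defining 𝒞.
module Submission where

open import Defs
open import Data.Nat using (ℕ; zero; suc)
open import Relation.Binary.PropositionalEquality
  using (_≡_; refl; sym; trans; cong; cong₂; subst; module ≡-Reasoning)

module Binomial where
  open import Data.Nat using (_+_; _*_; _∸_; _!; _≤_; _<_; z≤n; s≤s)
  open import Data.Nat.Properties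
    using (+-suc; m+n∸n≡m; m+n∸m≡n; m≤m+n; m≤n+m; n≤1+n; *-distribʳ-∸; *-comm; *-zeroʳ; *-identityˡ; *-identityʳ; *-monoˡ-≤; *-cancelˡ-≤; _!*_!≢0)
  open import Data.Nat.Combinatorics
    using (_C_; nCk≡nC[n∸k]; nCn≡1; nC1≡n; k>n⇒nCk≡0; nCk+nC[k+1]≡[n+1]C[k+1]; nCk≡n!/k![n-k]!)
  open import Data.Nat.DivMod using (_/_; /-congˡ; m*n/n≡m)
  open import Data.Nat.Tactic.RingSolver using (solve-∀)
  open ≡-Reasoning

  -- Pascal's rule as the definition, so that its instances hold by computation.
  binom : ℕ → ℕ → ℕ
  binom n       zero    = 1
  binom zero    (suc k) = 0
  binom (suc n) (suc k) = binom n k + binom n (suc k)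

  binom≡C : ∀ n k → binom n k ≡ n C k
  binom≡C n       zero    = sym (trans (nCk≡nC[n∸k] {0} {n} z≤n) (nCn≡1 n))
  binom≡C zero    (suc k) = sym (k>n⇒nCk≡0 {0} {suc k} (s≤s z≤n))
  binom≡C (suc n) (suc k) =
    trans (cong₂ _+_ (binom≡C n k) (binom≡C n (suc k))) (nCk+nC[k+1]≡[n+1]C[k+1] n k)

  k>n⇒binom≡0 : ∀ {n k} → n < k → binom n k ≡ 0
  k>n⇒binom≡0 {n} {k} n<k = trans (binom≡C n k) (k>n⇒nCk≡0 n<k)

  binom-diag : ∀ n → binom n n ≡ 1
  binom-diag n = trans (binom≡C n n) (nCn≡1 n)

  binom-sym : ∀ a b → binom (a + b) a ≡ binom (a + b) b
  binom-sym a b = begin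
    binom (a + b) a        ≡⟨ binom≡C (a + b) a ⟩
    (a + b) C a            ≡⟨ nCk≡nC[n∸k] (m≤m+n a b) ⟩
    (a + b) C (a + b ∸ a)  ≡⟨ cong ((a + b) C_) (m+n∸m≡n a b) ⟩
    (a + b) C b            ≡⟨ binom≡C (a + b) b ⟨
    binom (a + b) b        ∎

  binom-sym-central : ∀ m → binom (suc m + suc m) m ≡ binom (suc m + suc m) (suc (suc m))
  binom-sym-central m =
    subst (λ n → binom n m ≡ binom n (suc (suc m))) (+-suc m (suc m)) (binom-sym m (suc (suc m)))

  binom-absorb : ∀ n k → suc k * binom (suc n) (suc k) ≡ suc n * binom n k
  binom-absorb zero    zero    = refl
  binom-absorb zero    (suc k) = *-zeroʳ (suc (suc k))
  binom-absorb (suc n) zero    = begin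
    1 * binom (suc (suc n)) 1  ≡⟨ *-identityˡ _ ⟩
    binom (suc (suc n)) 1      ≡⟨ binom≡C (suc (suc n)) 1 ⟩
    suc (suc n) C 1            ≡⟨ nC1≡n (suc (suc n)) ⟩
    suc (suc n)                ≡⟨ *-identityʳ (suc (suc n)) ⟨
    suc (suc n) * 1            ∎
  binom-absorb (suc n) (suc k) = begin
    suc (suc k) * (binom (suc n) (suc k) + binom (suc n) (suc (suc k)))
      ≡⟨ split k (binom n k) (binom n (suc k)) (binom (suc n) (suc (suc k))) ⟩
    binom (suc n) (suc k) + suc k * binom (suc n) (suc k) + suc (suc k) * binom (suc n) (suc (suc k))
      ≡⟨ cong₂ (λ x y → binom (suc n) (suc k) + x + y) (binom-absorb n k) (binom-absorb n (suc k)) ⟩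
    binom (suc n) (suc k) + suc n * binom n k + suc n * binom n (suc k)
      ≡⟨ merge n (binom n k) (binom n (suc k)) ⟩
    suc (suc n) * binom (suc n) (suc k) ∎
    where
    split : ∀ k a b c → suc (suc k) * ((a + b) + c) ≡ (a + b) + suc k * (a + b) + suc (suc k) * c
    split = solve-∀
    merge : ∀ n a b → (a + b) + suc n * a + suc n * b ≡ suc (suc n) * (a + b)
    merge = solve-∀

  central-absorb : ∀ m → suc m * binom (m + m) (suc m) ≡ m * binom (m + m) m
  central-absorb zero    = refl
  central-absorb (suc m) = begin
    suc (suc m) * binom (suc m + suc m) (suc (suc m))  ≡⟨ binom-absorb (m + suc m) (suc m) ⟩
    suc (m + suc m) * binom (m + suc m) (suc m)        ≡⟨ cong (suc (m + suc m) *_) (binom-sym m (suc m)) ⟨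
    suc (m + suc m) * binom (m + suc m) m              ≡⟨ binom-absorb (m + suc m) m ⟨
    suc m * binom (suc m + suc m) (suc m)              ∎

  central-binom≡difference*[1+m] : ∀ m →
    binom (m + m) m ≡ (binom (m + m) m ∸ binom (m + m) (suc m)) * suc m
  central-binom≡difference*[1+m] m = sym (begin
    (X ∸ Y) * suc m            ≡⟨ *-distribʳ-∸ (suc m) X Y ⟩
    X * suc m ∸ Y * suc m      ≡⟨ cong₂ _∸_ (expand m X) (trans (*-comm Y (suc m)) (central-absorb m)) ⟩
    m * X + X ∸ m * X          ≡⟨ m+n∸m≡n (m * X) X ⟩
    X                          ∎)
    where
    X = binom (m + m) m
    Y = binom (m + m) (suc m)
    expand : ∀ m x → x * suc m ≡ m * x + x
    expand = solve-∀

  catalan≡central-difference : ∀ m → catalan m ≡ binom (m + m) m ∸ binom (m + m) (suc m)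
  catalan≡central-difference m = begin
    ((2 * m) C m) / suc m
      ≡⟨ /-congˡ (trans (cong (_C m) (double m)) (sym (binom≡C (m + m) m))) ⟩
    binom (m + m) m / suc m
      ≡⟨ /-congˡ (central-binom≡difference*[1+m] m) ⟩
    (binom (m + m) m ∸ binom (m + m) (suc m)) * suc m / suc m
      ≡⟨ m*n/n≡m _ (suc m) ⟩
    binom (m + m) m ∸ binom (m + m) (suc m) ∎
    where
    double : ∀ m → 2 * m ≡ m + m
    double = solve-∀

  central-binom≥next : ∀ m → binom (m + m) (suc m) ≤ binom (m + m) m
  central-binom≥next m = *-cancelˡ-≤ (suc m)
    (subst (_≤ suc m * binom (m + m) m) (sym (central-absorb m))
      (*-monoˡ-≤ (binom (m + m) m) (n≤1+n m)))

  factorialRatio : ℕ → ℕ → ℕ → ℕ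
  factorialRatio n a b = (n ! / (a ! * b !)) {{a !* b !≢0}}

  coeff-binom : ∀ i r → coeff (i + r) r ≡ binom (i + r + i) (i + i)
  coeff-binom i r = begin
    factorialRatio (2 * (i + r) ∸ r) r (2 * (i + r) ∸ 2 * r)
      ≡⟨ cong₂ (λ x y → factorialRatio x r y) 2[i+r]∸r≡n (trans 2[i+r]∸2r≡i+i (sym n∸r≡i+i)) ⟩
    factorialRatio n r (n ∸ r)  ≡⟨ nCk≡n!/k![n-k]! r≤n ⟨
    n C r                       ≡⟨ nCk≡nC[n∸k] r≤n ⟩
    n C (n ∸ r)                 ≡⟨ cong (n C_) n∸r≡i+i ⟩
    n C (i + i)                 ≡⟨ binom≡C n (i + i) ⟨
    binom n (i + i)             ∎
    where
    n = i + r + i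
    n≡2i+r : ∀ i r → i + r + i ≡ (i + i) + r
    n≡2i+r = solve-∀
    2[i+r]≡n+r : ∀ i r → 2 * (i + r) ≡ (i + r + i) + r
    2[i+r]≡n+r = solve-∀
    2[i+r]≡2i+2r : ∀ i r → 2 * (i + r) ≡ (i + i) + 2 * r
    2[i+r]≡2i+2r = solve-∀
    r≤n : r ≤ n
    r≤n = subst (r ≤_) (sym (n≡2i+r i r)) (m≤n+m r (i + i))
    n∸r≡i+i : n ∸ r ≡ i + i
    n∸r≡i+i = trans (cong (_∸ r) (n≡2i+r i r)) (m+n∸n≡m (i + i) r)
    2[i+r]∸r≡n : 2 * (i + r) ∸ r ≡ n
    2[i+r]∸r≡n = trans (cong (_∸ r) (2[i+r]≡n+r i r)) (m+n∸n≡m n r)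
    2[i+r]∸2r≡i+i : 2 * (i + r) ∸ 2 * r ≡ i + i
    2[i+r]∸2r≡i+i = trans (cong (_∸ 2 * r) (2[i+r]≡2i+2r i r)) (m+n∸n≡m (i + i) (2 * r))

open Binomial
open import Data.Nat as ℕ using (_∸_; _≤_; _<_; z≤n; s≤s)
import Data.Nat.Properties as ℕ
open import Data.Integer using (ℤ; +_; -_; _+_; _*_; _-_; _⊖_)
import Data.Integer.Properties as ℤ
open import Data.Integer.Tactic.RingSolver using (solve-∀)
open import Data.Vec using (Vec; []; _∷_)
open import Data.Nat.Induction using (<-rec)
open import Data.Product using (_,_)
open ≡-Reasoning

sgn-+-even : ∀ i n → sgn (i ℕ.+ n ℕ.+ i) ≡ sgn n
sgn-+-even zero    n = cong sgn (ℕ.+-identityʳ n)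
sgn-+-even (suc i) n rewrite ℕ.+-suc (i ℕ.+ n) i = trans (ℤ.neg-involutive _) (sgn-+-even i n)

Σ< : ℕ → (ℕ → ℤ) → ℤ
Σ< zero    f = + 0
Σ< (suc n) f = f 0 + Σ< n (λ i → f (suc i))

infix 5 Σ<
syntax Σ< n (λ i → e) = Σ[ i < n ] e

Σ<-cong : ∀ n {f g : ℕ → ℤ} → (∀ i → i < n → f i ≡ g i) → Σ< n f ≡ Σ< n g
Σ<-cong zero    f≡g = refl
Σ<-cong (suc n) f≡g =
  cong₂ _+_ (f≡g 0 (s≤s z≤n)) (Σ<-cong n (λ i i<n → f≡g (suc i) (s≤s i<n)))

Σ<-zero : ∀ n {f : ℕ → ℤ} → (∀ i → f i ≡ + 0) → Σ< n f ≡ + 0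
Σ<-zero zero    f≡0 = refl
Σ<-zero (suc n) f≡0 = cong₂ _+_ (f≡0 0) (Σ<-zero n (λ i → f≡0 (suc i)))

Σ<-last : ∀ n (f : ℕ → ℤ) → Σ< (suc n) f ≡ Σ< n f + f n
Σ<-last zero    f = ℤ.+-comm (f 0) (+ 0)
Σ<-last (suc n) f = begin
  f 0 + Σ< (suc n) (λ i → f (suc i))        ≡⟨ cong (_+_ (f 0)) (Σ<-last n (λ i → f (suc i))) ⟩
  f 0 + (Σ< n (λ i → f (suc i)) + f (suc n)) ≡⟨ ℤ.+-assoc (f 0) _ (f (suc n)) ⟨
  Σ< (suc n) f + f (suc n)                  ∎

Σ<-distrib-minus : ∀ n (f g : ℕ → ℤ) → Σ[ i < n ] (f i - g i) ≡ Σ< n f - Σ< n g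
Σ<-distrib-minus zero    f g = refl
Σ<-distrib-minus (suc n) f g = begin
  (f 0 - g 0) + (Σ[ i < n ] (f (suc i) - g (suc i)))
    ≡⟨ cong (_+_ (f 0 - g 0)) (Σ<-distrib-minus n (λ i → f (suc i)) (λ i → g (suc i))) ⟩
  (f 0 - g 0) + (Σ< n (λ i → f (suc i)) - Σ< n (λ i → g (suc i)))
    ≡⟨ regroup (f 0) (g 0) _ _ ⟩
  Σ< (suc n) f - Σ< (suc n) g ∎
  where
  regroup : ∀ a b x y → (a - b) + (x - y) ≡ (a + x) - (b + y)
  regroup = solve-∀

Σ<-*ˡ : ∀ n x (f : ℕ → ℤ) → Σ[ i < n ] (x * f i) ≡ x * Σ< n f
Σ<-*ˡ zero    x f = sym (ℤ.*-zeroʳ x)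
Σ<-*ˡ (suc n) x f = trans (cong (_+_ (x * f 0)) (Σ<-*ˡ n x (λ i → f (suc i))))
                          (sym (ℤ.*-distribˡ-+ x (f 0) _))

recCoeff : ℕ → ℕ → ℤ
recCoeff K i = sgn (K ℕ.+ i) * + binom (K ℕ.+ i) (i ℕ.+ i)

K<i⇒recCoeff≡0 : ∀ {K i} → K < i → recCoeff K i ≡ + 0
K<i⇒recCoeff≡0 {K} {i} K<i
  rewrite k>n⇒binom≡0 (ℕ.+-monoˡ-< i K<i) = ℤ.*-zeroʳ (sgn (K ℕ.+ i))

recCoeff-diag : ∀ K → recCoeff K K ≡ + 1
recCoeff-diag K = cong₂ (λ s b → s * + b) sgn[K+K]≡1 (binom-diag (K ℕ.+ K))
  where
  sgn[K+K]≡1 : sgn (K ℕ.+ K) ≡ + 1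
  sgn[K+K]≡1 = trans (cong (λ n → sgn (n ℕ.+ K)) (sym (ℕ.+-identityʳ K))) (sgn-+-even K 0)

recCoeff-rec-zero : ∀ K → recCoeff (suc (suc K)) 0 ≡ - (+ 2 * recCoeff (suc K) 0) - recCoeff K 0
recCoeff-rec-zero K = signs (sgn (K ℕ.+ 0))
  where
  signs : ∀ s → (- - s) * + 1 ≡ - (+ 2 * ((- s) * + 1)) - s * + 1
  signs = solve-∀

recCoeff-rec : ∀ K i → recCoeff (suc (suc K)) (suc i)
               ≡ recCoeff (suc K) i - + 2 * recCoeff (suc K) (suc i) - recCoeff K (suc i)
recCoeff-rec K i rewrite ℕ.+-suc K i | ℕ.+-suc i i =
  pascal² (sgn (K ℕ.+ i)) (+ binom n (i ℕ.+ i)) (+ binom n (suc (i ℕ.+ i))) (+ binom n (suc (suc (i ℕ.+ i))))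
  where
  n = suc (K ℕ.+ i)
  pascal² : ∀ s x y z → (- - - s) * (x + y + (y + z)) ≡ (- s) * x - + 2 * ((- - s) * (y + z)) - (- s) * z
  pascal² = solve-∀

recSum : ℕ → ℕ → (ℕ → ℤ) → ℤ
recSum K N a = Σ[ i < N ] recCoeff K i * a i

recSum-rec : ∀ K N (a : ℕ → ℤ) → recSum (suc (suc K)) (suc N) a
             ≡ recSum (suc K) N (λ i → a (suc i)) - + 2 * recSum (suc K) (suc N) a - recSum K (suc N) a
recSum-rec K N a = begin
  recCoeff (suc (suc K)) 0 * a 0 + (Σ[ i < N ] recCoeff (suc (suc K)) (suc i) * a (suc i))
    ≡⟨ cong₂ (λ c s → c * a 0 + s) (recCoeff-rec-zero K) (Σ<-cong N λ i _ → termwise i) ⟩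
  (- (+ 2 * p) - q) * a 0 + (Σ[ i < N ] f i - + 2 * g i - h i)
    ≡⟨ cong (_+_ ((- (+ 2 * p) - q) * a 0)) (Σ<-linear N f g h) ⟩
  (- (+ 2 * p) - q) * a 0 + (Σ< N f - + 2 * Σ< N g - Σ< N h)
    ≡⟨ regroup p q (a 0) (Σ< N f) (Σ< N g) (Σ< N h) ⟩
  Σ< N f - + 2 * (p * a 0 + Σ< N g) - (q * a 0 + Σ< N h) ∎
  where
  p = recCoeff (suc K) 0
  q = recCoeff K 0
  f g h : ℕ → ℤ
  f i = recCoeff (suc K) i * a (suc i)
  g i = recCoeff (suc K) (suc i) * a (suc i)
  h i = recCoeff K (suc i) * a (suc i)
  termwise : ∀ i → recCoeff (suc (suc K)) (suc i) * a (suc i) ≡ f i - + 2 * g i - h i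
  termwise i rewrite recCoeff-rec K i =
    distrib (recCoeff (suc K) i) (recCoeff (suc K) (suc i)) (recCoeff K (suc i)) (a (suc i))
    where
    distrib : ∀ x y z b → (x - + 2 * y - z) * b ≡ x * b - + 2 * (y * b) - z * b
    distrib = solve-∀
  Σ<-linear : ∀ N f g h → Σ[ i < N ] f i - + 2 * g i - h i ≡ Σ< N f - + 2 * Σ< N g - Σ< N h
  Σ<-linear N f g h = begin
    Σ[ i < N ] f i - + 2 * g i - h i        ≡⟨ Σ<-distrib-minus N _ h ⟩
    (Σ[ i < N ] (f i - + 2 * g i)) - Σ< N h ≡⟨ cong (_- Σ< N h) (Σ<-distrib-minus N f _) ⟩
    Σ< N f - (Σ[ i < N ] + 2 * g i) - Σ< N h ≡⟨ cong (λ t → Σ< N f - t - Σ< N h) (Σ<-*ˡ N (+ 2) g) ⟩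
    Σ< N f - + 2 * Σ< N g - Σ< N h          ∎
  regroup : ∀ p q b x y z → (- (+ 2 * p) - q) * b + (x - + 2 * y - z) ≡ x - + 2 * (p * b + y) - (q * b + z)
  regroup = solve-∀

recSum-beyond : ∀ K N (a : ℕ → ℤ) → Σ[ i < N ] recCoeff K (suc K ℕ.+ i) * a (suc K ℕ.+ i) ≡ + 0
recSum-beyond K N a = Σ<-zero N λ i →
  trans (cong (_* a (suc K ℕ.+ i)) (K<i⇒recCoeff≡0 (ℕ.m≤m+n (suc K) i))) (ℤ.*-zeroˡ (a (suc K ℕ.+ i)))

centralRow : ℕ → ℕ → ℤ
centralRow m j = + binom (m ℕ.+ m) (j ℕ.+ m)

centralRow-suc : ∀ m j → centralRow (suc m) (suc j)
                 ≡ centralRow m j + + 2 * centralRow m (suc j) + centralRow m (suc (suc j))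
centralRow-suc m j rewrite ℕ.+-suc m m | ℕ.+-suc j m =
  pascal² (centralRow m j) (centralRow m (suc j)) (centralRow m (suc (suc j)))
  where
  pascal² : ∀ x y z → x + y + (y + z) ≡ x + + 2 * y + z
  pascal² = solve-∀

centralRow-suc-zero : ∀ m → centralRow (suc m) 0 ≡ + 2 * centralRow m 0 + + 2 * centralRow m 1
centralRow-suc-zero zero    = refl
centralRow-suc-zero (suc m) rewrite ℕ.+-suc m (suc m) | binom-sym-central m =
  pascal² (centralRow (suc m) 0) (centralRow (suc m) 1)
  where
  pascal² : ∀ y z → z + y + (y + z) ≡ + 2 * y + + 2 * z
  pascal² = solve-∀

ballot : ℕ → ℕ → ℤ
ballot m j = centralRow m j - centralRow m (suc j)

ballot-suc-zero : ∀ m → ballot (suc m) 0 ≡ ballot m 0 + ballot m 1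
ballot-suc-zero m rewrite centralRow-suc-zero m | centralRow-suc m 0 =
  telescope (centralRow m 0) (centralRow m 1) (centralRow m 2)
  where
  telescope : ∀ a b c → + 2 * a + + 2 * b - (a + + 2 * b + c) ≡ a - b + (b - c)
  telescope = solve-∀

ballot-suc-suc : ∀ m j → ballot (suc m) (suc j) ≡ ballot m j + + 2 * ballot m (suc j) + ballot m (suc (suc j))
ballot-suc-suc m j rewrite centralRow-suc m j | centralRow-suc m (suc j) =
  telescope (centralRow m j) (centralRow m (suc j)) (centralRow m (suc (suc j))) (centralRow m (suc (suc (suc j))))
  where
  telescope : ∀ a b c d → a + + 2 * b + c - (b + + 2 * c + d) ≡ a - b + + 2 * (b - c) + (c - d)
  telescope = solve-∀

ballot-zero≡catalan : ∀ m → ballot m 0 ≡ + catalan m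
ballot-zero≡catalan m = begin
  + X - + Y  ≡⟨ ℤ.m-n≡m⊖n X Y ⟩
  X ⊖ Y      ≡⟨ ℤ.⊖-≥ (central-binom≥next m) ⟩
  + (X ∸ Y)  ≡⟨ cong +_ (catalan≡central-difference m) ⟨
  + catalan m ∎
  where
  X = binom (m ℕ.+ m) m
  Y = binom (m ℕ.+ m) (suc m)

recSum-ballot : ∀ K N m → K < N → recSum K N (λ i → ballot (m ℕ.+ i) 0) ≡ ballot m K
recSum-ballot zero (suc N) m _ = begin
  + 1 * ballot (m ℕ.+ 0) 0 + (Σ[ i < N ] recCoeff 0 (suc i) * ballot (m ℕ.+ suc i) 0)
    ≡⟨ cong (_+_ (+ 1 * ballot (m ℕ.+ 0) 0)) (recSum-beyond 0 N (λ i → ballot (m ℕ.+ i) 0)) ⟩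
  + 1 * ballot (m ℕ.+ 0) 0 + + 0
    ≡⟨ cong (λ n → + 1 * ballot n 0 + + 0) (ℕ.+-identityʳ m) ⟩
  + 1 * ballot m 0 + + 0
    ≡⟨ trans (ℤ.+-identityʳ _) (ℤ.*-identityˡ _) ⟩
  ballot m 0 ∎
recSum-ballot (suc zero) (suc (suc N)) m _ = begin
  - + 1 * ballot (m ℕ.+ 0) 0 + (+ 1 * ballot (m ℕ.+ 1) 0
    + (Σ[ i < N ] recCoeff 1 (2 ℕ.+ i) * ballot (m ℕ.+ (2 ℕ.+ i)) 0))
    ≡⟨ cong (λ t → - + 1 * ballot (m ℕ.+ 0) 0 + (+ 1 * ballot (m ℕ.+ 1) 0 + t))
            (recSum-beyond 1 N (λ i → ballot (m ℕ.+ i) 0)) ⟩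
  - + 1 * ballot (m ℕ.+ 0) 0 + (+ 1 * ballot (m ℕ.+ 1) 0 + + 0)
    ≡⟨ cong₂ (λ n n′ → - + 1 * ballot n 0 + (+ 1 * ballot n′ 0 + + 0)) (ℕ.+-identityʳ m) (ℕ.+-comm m 1) ⟩
  - + 1 * ballot m 0 + (+ 1 * ballot (suc m) 0 + + 0)
    ≡⟨ cong (λ t → - + 1 * ballot m 0 + (+ 1 * t + + 0)) (ballot-suc-zero m) ⟩
  - + 1 * ballot m 0 + (+ 1 * (ballot m 0 + ballot m 1) + + 0)
    ≡⟨ cancel (ballot m 0) (ballot m 1) ⟩
  ballot m 1 ∎
  where
  cancel : ∀ x y → - + 1 * x + (+ 1 * (x + y) + + 0) ≡ y
  cancel = solve-∀
recSum-ballot (suc zero) (suc zero) m (s≤s ())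
recSum-ballot (suc (suc K)) (suc N) m 2+K<1+N = begin
  recSum (suc (suc K)) (suc N) a
    ≡⟨ recSum-rec K N a ⟩
  recSum (suc K) N (λ i → a (suc i)) - + 2 * recSum (suc K) (suc N) a - recSum K (suc N) a
    ≡⟨ cong₂ (λ x y → x - + 2 * y - recSum K (suc N) a) shifted (recSum-ballot (suc K) (suc N) m 1+K<1+N) ⟩
  ballot (suc m) (suc K) - + 2 * ballot m (suc K) - recSum K (suc N) a
    ≡⟨ cong (_-_ (ballot (suc m) (suc K) - + 2 * ballot m (suc K))) (recSum-ballot K (suc N) m K<1+N) ⟩
  ballot (suc m) (suc K) - + 2 * ballot m (suc K) - ballot m K
    ≡⟨ cong (λ t → t - + 2 * ballot m (suc K) - ballot m K) (ballot-suc-suc m K) ⟩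
  ballot m K + + 2 * ballot m (suc K) + ballot m (suc (suc K)) - + 2 * ballot m (suc K) - ballot m K
    ≡⟨ cancel (ballot m K) (ballot m (suc K)) (ballot m (suc (suc K))) ⟩
  ballot m (suc (suc K)) ∎
  where
  a : ℕ → ℤ
  a i = ballot (m ℕ.+ i) 0
  1+K<N : suc K < N
  1+K<N = ℕ.≤-pred 2+K<1+N
  1+K<1+N : suc K < suc N
  1+K<1+N = ℕ.m<n⇒m<1+n 1+K<N
  K<1+N : K < suc N
  K<1+N = ℕ.<-trans (ℕ.n<1+n K) 1+K<1+N
  shifted : recSum (suc K) N (λ i → a (suc i)) ≡ ballot (suc m) (suc K)
  shifted = trans (Σ<-cong N λ i _ → cong (λ n → recCoeff (suc K) i * ballot n 0) (ℕ.+-suc m i))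
                  (recSum-ballot (suc K) N (suc m) 1+K<N)
  cancel : ∀ x y z → x + + 2 * y + z - + 2 * y - x ≡ z
  cancel = solve-∀

ballot-zero-rec : ∀ k → ballot (suc k) 0 ≡ - (Σ[ i < suc k ] recCoeff (suc k) i * ballot i 0)
ballot-zero-rec k = begin
  b                 ≡⟨ isolate S b ⟩
  (S + + 1 * b) - S ≡⟨ cong (_- S) total≡0 ⟩
  + 0 - S           ≡⟨ ℤ.+-identityˡ (- S) ⟩
  - S               ∎
  where
  b = ballot (suc k) 0
  S = Σ[ i < suc k ] recCoeff (suc k) i * ballot i 0
  isolate : ∀ S b → b ≡ (S + + 1 * b) - S
  isolate = solve-∀
  total≡0 : S + + 1 * b ≡ + 0
  total≡0 = begin
    S + + 1 * b
      ≡⟨ cong (λ c → S + c * b) (recCoeff-diag (suc k)) ⟨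
    S + recCoeff (suc k) (suc k) * b
      ≡⟨ Σ<-last (suc k) (λ i → recCoeff (suc k) i * ballot i 0) ⟨
    recSum (suc k) (suc (suc k)) (λ i → ballot i 0)
      ≡⟨ recSum-ballot (suc k) (suc (suc k)) 0 (ℕ.n<1+n (suc k)) ⟩
    + 0 ∎

signedSum : ℕ → ℕ → {n : ℕ} → Vec ℤ n → ℤ
signedSum k μ []       = + 0
signedSum k μ (c ∷ cs) = sgn μ * + coeff (suc k) μ * c + signedSum k (suc μ) cs

signedSum-unique : ∀ k (G : ℕ → {n : ℕ} → Vec ℤ n → ℤ) →
  (∀ μ → G μ [] ≡ + 0) →
  (∀ μ c {n} (cs : Vec ℤ n) → G μ (c ∷ cs) ≡ sgn μ * + coeff (suc k) μ * c + G (suc μ) cs) →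
  ∀ μ {n} (xs : Vec ℤ n) → G μ xs ≡ signedSum k μ xs
signedSum-unique k G nil cons μ []       = nil μ
signedSum-unique k G nil cons μ (c ∷ cs) =
  trans (cons μ c cs) (cong (_+_ (sgn μ * + coeff (suc k) μ * c)) (signedSum-unique k G nil cons (suc μ) cs))

mutual
  -- The local summation function of `step` cannot be named; this metavariable is solved to it
  -- by unification in `step≡`, where `with` has made all of its arguments variables.
  stepSum : (k : ℕ) → Vec ℤ (suc k) → ℕ → {n : ℕ} → Vec ℤ n → ℤ
  stepSum = _

  step≡ : ∀ k (v : Vec ℤ (suc k)) → step k v ≡ - signedSum k 1 v
  step≡ zero    (x ∷ [])     = refl
  step≡ (suc m) (x ∷ y ∷ zs) with suc m | x ∷ y ∷ zs | 3
  ... | k | v | μ =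
    cong (λ t → - (sgn 1 * + coeff (suc (suc m)) 1 * x + (sgn 2 * + coeff (suc (suc m)) 2 * y + t)))
         (signedSum-unique k (stepSum k v) (λ _ → refl) (λ _ _ _ → refl) μ zs)

signedSum-tab : ∀ k j μ → μ ℕ.+ j ≡ suc k →
  signedSum k μ (tab j) ≡ Σ[ i < suc j ] sgn (suc k ∸ i) * + coeff (suc k) (suc k ∸ i) * scrC i
signedSum-tab k zero μ μ+0≡1+k with trans (sym (ℕ.+-identityʳ μ)) μ+0≡1+k
... | refl = refl
signedSum-tab k (suc j) μ μ+1+j≡1+k = begin
  term μ (suc j) + signedSum k (suc μ) (tab j)
    ≡⟨ cong₂ _+_ (cong (λ ν → term ν (suc j)) μ≡1+k∸1+j)
                 (signedSum-tab k j (suc μ) (trans (sym (ℕ.+-suc μ j)) μ+1+j≡1+k)) ⟩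
  term (suc k ∸ suc j) (suc j) + (Σ[ i < suc j ] term (suc k ∸ i) i)
    ≡⟨ ℤ.+-comm (term (suc k ∸ suc j) (suc j)) _ ⟩
  (Σ[ i < suc j ] term (suc k ∸ i) i) + term (suc k ∸ suc j) (suc j)
    ≡⟨ Σ<-last (suc j) (λ i → term (suc k ∸ i) i) ⟨
  Σ[ i < suc (suc j) ] term (suc k ∸ i) i ∎
  where
  term : ℕ → ℕ → ℤ
  term μ i = sgn μ * + coeff (suc k) μ * scrC i
  μ≡1+k∸1+j : μ ≡ suc k ∸ suc j
  μ≡1+k∸1+j = sym (trans (cong (_∸ suc j) (sym μ+1+j≡1+k)) (ℕ.m+n∸n≡m μ (suc j)))

sgn-coeff≡recCoeff : ∀ {K i} → i ≤ K → sgn (K ∸ i) * + coeff K (K ∸ i) ≡ recCoeff K i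
sgn-coeff≡recCoeff {K} {i} i≤K with ℕ.m≤n⇒∃[o]m+o≡n i≤K
... | r , refl rewrite ℕ.m+n∸m≡n i r | coeff-binom i r =
  cong (_* + binom (i ℕ.+ r ℕ.+ i) (i ℕ.+ i)) (sym (sgn-+-even i r))

scrC-rec : ∀ k → scrC (suc k) ≡ - (Σ[ i < suc k ] recCoeff (suc k) i * scrC i)
scrC-rec k = begin
  step k (tab k)           ≡⟨ step≡ k (tab k) ⟩
  - signedSum k 1 (tab k)  ≡⟨ cong -_ (signedSum-tab k k 1 refl) ⟩
  - (Σ[ i < suc k ] sgn (suc k ∸ i) * + coeff (suc k) (suc k ∸ i) * scrC i)
    ≡⟨ cong -_ (Σ<-cong (suc k) λ i i<1+k → cong (_* scrC i) (sgn-coeff≡recCoeff (ℕ.<⇒≤ i<1+k))) ⟩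
  - (Σ[ i < suc k ] recCoeff (suc k) i * scrC i) ∎

scrC≡ballot : ∀ k → scrC k ≡ ballot k 0
scrC≡ballot = <-rec (λ k → scrC k ≡ ballot k 0) λ where
  zero    _  → refl
  (suc k) ih → begin
    scrC (suc k)                                      ≡⟨ scrC-rec k ⟩
    - (Σ[ i < suc k ] recCoeff (suc k) i * scrC i)     ≡⟨ cong -_ (Σ<-cong (suc k) λ i i<1+k →
                                                           cong (recCoeff (suc k) i *_) (ih i<1+k)) ⟩
    - (Σ[ i < suc k ] recCoeff (suc k) i * ballot i 0) ≡⟨ ballot-zero-rec k ⟨
    ballot (suc k) 0                                  ∎

lemma3p4 : (k : ℕ) → scrC k ≡ + catalan k
lemma3p4 k = trans (scrC≡ballot k) (ballot-zero≡catalan k)
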